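{- Let $n$ and $m$ be positive integers with $m\geq n+1$, let $P=(x_1,y_1)\cdots(x_{n+1},y_{n+1})$ be an $(n,m)$-lattice path, and let $\Theta=\Theta_P:\{1,\ldots,m\}\to\mathcal{PL}(P)$ be as defined in the context. Then $PNPL(\Theta(r))=r-1$ for every $r\in\{1,\ldots,m\}$.
   Context: An $(n,m)$-lattice path is a sequence $Q=(u_1,v_1)\cdots(u_{n+1},v_{n+1})$ of vectors in $\mathbb{Z}^2$ such that $1-n\leq v_i\leq 1$, $\sum_i v_i=1$, $1\leq u_i\leq m-1$, $\sum_i u_i=m$. For such $Q$, $NP(Q)=\{i\in\{1,\ldots,n+1\}\mid \sum_{k=1}^{i}v_k\leq 0\}$ and $NPL(Q)=\sum_{i\in NP(Q)}u_i$. A pointed $(n,m)$-lattice path is a pair $\dot{Q}=[Q;j]$ with $0\leq j\leq u_{n+1}-1$, and its pointed non-positive length is $PNPL(\dot{Q})=NPL(Q)+j$. For $P$ as in the claim and $i\in\{1,\ldots,n+1\}$, let $P_i=(x_{i+1},y_{i+1})\cdots(x_{n+1},y_{n+1})(x_1,y_1)\cdots(x_i,y_i)$ (so $P_{n+1}=P$), and let $\dot{P}(i;j)=[P_i;j]$ for $0\leq j\leq x_i-1$; $\mathcal{PL}(P)=\{\dot{P}(i;j)\mid i\in\{1,\ldots,n+1\},\ 0\leq j\leq x_i-1\}$ (it has $m$ elements, one for each such pair $(i,j)$). Let $s_i=\sum_{k=1}^{i}y_k$. Define a linear order $<_P$ on $\{1,\ldots,n+1\}$ by: $i<_P j$ iff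 either $s_i<s_j$, or $s_i=s_j$ and $i>j$. Define a linear order $\prec_P$ on $\mathcal{PL}(P)$ by: $\dot{P}(i_1;j_1)\prec_P\dot{P}(i_2;j_2)$ iff either $i_1<_P i_2$, or $i_1=i_2$ and $j_1<j_2$. Let $\Theta_P(r)$ be the $r$-th element of $\mathcal{PL}(P)$ in increasing $\prec_P$-order, for $r=1,\ldots,m$. -}

module Defs where

open import Data.Nat as ℕ using (ℕ; zero; suc; _∸_)
open import Data.Integer as ℤ using (ℤ; +_)
open import Data.Product using (_×_; _,_; proj₁; proj₂; Σ)
open import Data.Sum using (_⊎_)
open import Data.Nat.ListAction using (sum)
open import Data.List using (List; []; _∷_; length; map; take; drop; _++_; filter; concatMap; upTo)
open import Data.List.Relation.Unary.All using (All)
open import Relation.Binary.PropositionalEquality using (_≡_)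
open import Relation.Nullary using (Dec; yes; no)
open import Relation.Nullary.Decidable using (_⊎-dec_; _×-dec_)

-- A step (u , v) ∈ ℤ² ; u is always positive so we store it in ℕ.
Step : Set
Step = ℕ × ℤ

sumU : List Step → ℕ
sumU Q = sum (map proj₁ Q)

sumV : List Step → ℤ
sumV []             = + 0
sumV ((_ , v) ∷ Q)  = v ℤ.+ sumV Q

IsLatticePath : ℕ → ℕ → List Step → Set
IsLatticePath n m Q =
  length Q ≡ suc n
  × All (λ s → (1 ℕ.≤ proj₁ s × proj₁ s ℕ.≤ m ∸ 1)
             × ((+ 1 ℤ.- + n) ℤ.≤ proj₂ s × proj₂ s ℤ.≤ + 1)) Q
  × sumV Q ≡ + 1
  × sumU Q ≡ m

-- NPL(Q) = Σ_{i ∈ NP(Q)} u_i, where i ∈ NP(Q) iff v_1+⋯+v_i ≤ 0.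
-- nplFrom s Q processes the remaining steps with current prefix sum s.
nplFrom : ℤ → List Step → ℕ
nplFrom s []             = 0
nplFrom s ((u , v) ∷ Q) with (s ℤ.+ v) ℤ.≤? + 0
... | yes _ = u ℕ.+ nplFrom (s ℤ.+ v) Q
... | no  _ = nplFrom (s ℤ.+ v) Q

NPL : List Step → ℕ
NPL Q = nplFrom (+ 0) Q

PNPL : List Step → ℕ → ℕ
PNPL Q j = NPL Q ℕ.+ j

-- Notation for a fixed path P (indices i are 1-based).
-- P_i = (x_{i+1},y_{i+1})⋯(x_{n+1},y_{n+1})(x_1,y_1)⋯(x_i,y_i)
rot : List Step → ℕ → List Step
rot P i = drop i P ++ take i P

xAt : List Step → ℕ → ℕ
xAt P i = sumU (take 1 (drop (i ∸ 1) P))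

sAt : List Step → ℕ → ℤ
sAt P i = sumV (take i P)

_<[_]_ : ℕ → List Step → ℕ → Set
i <[ P ] j = (sAt P i ℤ.< sAt P j) ⊎ ((sAt P i ≡ sAt P j) × (j ℕ.< i))

-- An element Ṗ(i;j) of PL(P) is represented by its index pair (i , j).
-- Ṗ(i₁;j₁) ≺_P Ṗ(i₂;j₂)  iff  i₁ <_P i₂, or i₁ = i₂ and j₁ < j₂
_≺[_]_ : ℕ × ℕ → List Step → ℕ × ℕ → Set
(i₁ , j₁) ≺[ P ] (i₂ , j₂) = (i₁ <[ P ] i₂) ⊎ ((i₁ ≡ i₂) × (j₁ ℕ.< j₂))

≺-dec : (P : List Step) (a b : ℕ × ℕ) → Dec (a ≺[ P ] b)
≺-dec P (i₁ , j₁) (i₂ , j₂) =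
  ((sAt P i₁ ℤ.<? sAt P i₂) ⊎-dec ((sAt P i₁ ℤ.≟ sAt P i₂) ×-dec (i₂ ℕ.<? i₁)))
  ⊎-dec ((i₁ ℕ.≟ i₂) ×-dec (j₁ ℕ.<? j₂))

PLindices : List Step → List (ℕ × ℕ)
PLindices P = concatMap (λ k → map (λ j → (suc k , j)) (upTo (xAt P (suc k)))) (upTo (length P))

InPL : List Step → ℕ × ℕ → Set
InPL P (i , j) = (1 ℕ.≤ i × i ℕ.≤ length P) × j ℕ.< xAt P i

-- Ṗ(i;j) is the r-th element of PL(P) in increasing ≺_P-order, i.e. Θ_P(r) = Ṗ(i;j):
-- it lies in PL(P) and exactly r - 1 elements of PL(P) are ≺_P-below it.
IsTheta : List Step → ℕ → ℕ × ℕ → Set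
IsTheta P r e = InPL P e × length (filter (λ e′ → ≺-dec P e′ e) (PLindices P)) ≡ r ∸ 1

PNPLat : List Step → ℕ × ℕ → ℕ
PNPLat P (i , j) = PNPL (rot P i) j

-- Both the ≺_P-rank of Ṗ(i;j) in PL(P) and PNPL(Ṗ(i;j)) equal Σ_{k <_P i} x_k + j. For the rank
-- this is the lexicographic shape of ≺_P. For PNPL, the prefix of P_i ending with the step that
-- comes from position k of P has y-sum s_k − s_i when k > i and s_k + 1 − s_i when k ≤ i, and this
-- is ≤ 0 exactly when k <_P i. Since ≺_P is a strict total order on the m distinct elements of
-- PL(P), every rank 0, …, m − 1 is attained.
module Submission where

open import Defs
open import Data.Nat as ℕ using (ℕ; zero; suc; _+_; _∸_; _≤_; _<_; z≤n; s≤s)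
import Data.Nat.Properties as ℕₚ
open import Data.Nat.ListAction using (sum)
open import Data.Integer as ℤ using (ℤ; +_)
import Data.Integer.Properties as ℤₚ
open import Data.Integer.Tactic.RingSolver using (solve)
open import Data.Bool using (true; false; if_then_else_)
open import Data.Product using (Σ; _×_; _,_; proj₁; proj₂)
open import Data.Product.Relation.Binary.Lex.Strict using (×-Lex; ×-isStrictTotalOrder)
open import Data.Product.Relation.Binary.Pointwise.NonDependent using (Pointwise; ≡×≡⇒≡; ≡⇒≡×≡)
open import Data.Sum using (_⊎_; inj₁; inj₂)
open import Data.List
  using (List; []; _∷_; [_]; _∷ʳ_; length; map; take; drop; _++_; filter; concat; upTo; applyUpTo)
import Data.List.Properties as Listₚ
open import Data.List.Membership.Propositional using (_∈_)
open import Data.List.Membership.Propositional.Properties using (∈-map⁻; ∈-concat⁻′; ∈-upTo⁻)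
open import Data.List.Relation.Unary.All as All using (All)
import Data.List.Relation.Unary.All.Properties as Allₚ
open import Data.List.Relation.Unary.Any using (here; there)
open import Data.List.Relation.Unary.AllPairs using (_∷_)
import Data.List.Relation.Unary.AllPairs.Properties as AllPairsₚ
open import Data.List.Relation.Unary.Unique.Propositional using (Unique)
import Data.List.Relation.Unary.Unique.Propositional.Properties as Uniqueₚ
open import Data.List.Relation.Binary.Disjoint.Propositional using (Disjoint)
open import Data.List.Relation.Binary.Sublist.Propositional using (⊆-refl)
open import Data.List.Relation.Binary.Sublist.Propositional.Properties using (filter⁺; length-mono-≤)
open import Algebra.Properties.CommutativeSemigroup ℕₚ.+-commutativeSemigroup using (interchange)
open import Function using (_∘_; id; flip; _⇔_; mk⇔)
open import Level using (0ℓ)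
open import Relation.Binary using (Rel; IsStrictTotalOrder; tri<; tri≈; tri>)
open import Relation.Binary.Morphism.Structures using (IsOrderMonomorphism)
import Relation.Binary.Morphism.OrderMonomorphism as OrderMonomorphism
import Relation.Binary.Construct.Flip.EqAndOrd as Flip
open import Relation.Binary.PropositionalEquality
  using (_≡_; _≢_; refl; sym; trans; cong; cong₂; subst; module ≡-Reasoning)
open import Relation.Nullary using (Dec; yes; no; does; ¬_; contradiction)
open import Relation.Nullary.Decidable using (does-⇔; dec-true; dec-false; _⊎-dec_; _×-dec_)
open import Relation.Unary as U using (Pred; _⊆_)

open ≡-Reasoning

module _ {A : Set} {P Q : Pred A 0ℓ} (P? : U.Decidable P) (Q? : U.Decidable Q) (P⊆Q : P ⊆ Q) where

  length-filter-mono : ∀ xs → length (filter P? xs) ≤ length (filter Q? xs)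
  length-filter-mono xs = length-mono-≤ (filter⁺ P? Q? (λ { refl → P⊆Q }) (⊆-refl {x = xs}))

  length-filter-strict : ∀ {x} xs → x ∈ xs → Q x → ¬ P x →
                         length (filter P? xs) < length (filter Q? xs)
  length-filter-strict (x ∷ xs) (here refl) qx ¬px with P? x | Q? x
  ... | yes px | _      = contradiction px ¬px
  ... | no _   | no ¬qx = contradiction qx ¬qx
  ... | no _   | yes _  = s≤s (length-filter-mono xs)
  length-filter-strict (y ∷ xs) (there x∈xs) qx ¬px with P? y | Q? y
  ... | yes py | no ¬qy = contradiction (P⊆Q py) ¬qy
  ... | yes _  | yes _  = s≤s (length-filter-strict xs x∈xs qx ¬px)
  ... | no _   | yes _  = ℕₚ.m≤n⇒m≤1+n (length-filter-strict xs x∈xs qx ¬px)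
  ... | no _   | no _   = length-filter-strict xs x∈xs qx ¬px

length-filter-map : ∀ {A B : Set} {P : Pred B 0ℓ} (P? : U.Decidable P) (f : A → B) xs →
                    length (filter P? (map f xs)) ≡ length (filter (P? ∘ f) xs)
length-filter-map P? f [] = refl
length-filter-map P? f (x ∷ xs) with does (P? (f x))
... | true  = cong suc (length-filter-map P? f xs)
... | false = length-filter-map P? f xs

module _ {A : Set} {P : Pred A 0ℓ} (P? : U.Decidable P) where

  filter-concat : ∀ xss → filter P? (concat xss) ≡ concat (map (filter P?) xss)
  filter-concat []         = refl
  filter-concat (xs ∷ xss) =
    trans (Listₚ.filter-++ P? xs (concat xss)) (cong (filter P? xs ++_) (filter-concat xss))

length-concat : ∀ {A : Set} (xss : List (List A)) → length (concat xss) ≡ sum (map length xss)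
length-concat []         = refl
length-concat (xs ∷ xss) = trans (Listₚ.length-++ xs) (cong (_+_ (length xs)) (length-concat xss))

filter-<-upTo : ∀ {j} x → j ≤ x → filter (ℕ._<? j) (upTo x) ≡ upTo j
filter-<-upTo zero z≤n = refl
filter-<-upTo {j} (suc x) j≤1+x with ℕₚ.m≤n⇒m<n∨m≡n j≤1+x
... | inj₂ refl = Listₚ.filter-all (ℕ._<? j) (All.tabulate ∈-upTo⁻)
... | inj₁ (s≤s j≤x) = begin
  filter (ℕ._<? j) (upTo (suc x))                        ≡⟨ cong (filter (ℕ._<? j)) (Listₚ.upTo-∷ʳ x) ⟨
  filter (ℕ._<? j) (upTo x ∷ʳ x)                         ≡⟨ Listₚ.filter-++ (ℕ._<? j) (upTo x) [ x ] ⟩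
  filter (ℕ._<? j) (upTo x) ++ filter (ℕ._<? j) [ x ]   ≡⟨ cong₂ _++_ (filter-<-upTo x j≤x)
                                                             (Listₚ.filter-reject (ℕ._<? j) (ℕₚ.≤⇒≯ j≤x)) ⟩
  upTo j ++ []                                           ≡⟨ Listₚ.++-identityʳ (upTo j) ⟩
  upTo j                                                 ∎

applyUpTo-cong : ∀ {A : Set} {f g : ℕ → A} → (∀ k → f k ≡ g k) → ∀ n → applyUpTo f n ≡ applyUpTo g n
applyUpTo-cong f≗g zero    = refl
applyUpTo-cong f≗g (suc n) = cong₂ _∷_ (f≗g 0) (applyUpTo-cong (f≗g ∘ suc) n)

sum-applyUpTo-+ : ∀ (f g : ℕ → ℕ) n →
                  sum (applyUpTo (λ k → f k + g k) n) ≡ sum (applyUpTo f n) + sum (applyUpTo g n)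
sum-applyUpTo-+ f g zero    = refl
sum-applyUpTo-+ f g (suc n) =
  trans (cong (_+_ (f 0 + g 0)) (sum-applyUpTo-+ (f ∘ suc) (g ∘ suc) n)) (interchange (f 0) (g 0) _ _)

sum-applyUpTo-single : ∀ (f : ℕ → ℕ) {t n} → t < n → (∀ k → k ≢ t → f k ≡ 0) →
                       sum (applyUpTo f n) ≡ f t
sum-applyUpTo-single f {zero} {suc n} _ f≡0 =
  trans (cong (_+_ (f 0)) (sum-zeros (f ∘ suc) n (λ k → f≡0 (suc k) λ ()))) (ℕₚ.+-identityʳ (f 0))
  where
    sum-zeros : ∀ g n → (∀ k → g k ≡ 0) → sum (applyUpTo g n) ≡ 0
    sum-zeros g zero    _    = refl
    sum-zeros g (suc n) g≡0 = cong₂ _+_ (g≡0 0) (sum-zeros (g ∘ suc) n (g≡0 ∘ suc))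
sum-applyUpTo-single f {suc t} {suc n} (s≤s t<n) f≡0 =
  trans (cong (_+ sum (applyUpTo (f ∘ suc) n)) (f≡0 0 λ ()))
        (sum-applyUpTo-single (f ∘ suc) t<n (λ k k≢t → f≡0 (suc k) (k≢t ∘ ℕₚ.suc-injective)))

module Rank {A : Set} {_≺_ : Rel A 0ℓ} (≺-isStrictTotalOrder : IsStrictTotalOrder _≡_ _≺_)
            (_≺?_ : ∀ a b → Dec (a ≺ b)) where

  open IsStrictTotalOrder ≺-isStrictTotalOrder
    using (compare) renaming (irrefl to ≺-irrefl; trans to ≺-trans)

  rank : List A → A → ℕ
  rank xs b = length (filter (_≺? b) xs)

  rank-mono : ∀ {a b} xs → a ≺ b → rank xs a ≤ rank xs b
  rank-mono xs a≺b = length-filter-mono (_≺? _) (_≺? _) (λ x≺a → ≺-trans x≺a a≺b) xs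

  rank-strict : ∀ {a b} xs → a ∈ xs → a ≺ b → rank xs a < rank xs b
  rank-strict xs a∈xs a≺b =
    length-filter-strict (_≺? _) (_≺? _) (λ x≺a → ≺-trans x≺a a≺b) xs a∈xs a≺b (≺-irrefl refl)

  -- Adding the head x to the tail leaves the ranks below rank xs x unchanged and shifts the
  -- ranks from rank xs x on up by one.
  rank-surjective : ∀ {xs} → Unique xs → ∀ {r} → r < length xs → Σ A λ e → e ∈ xs × rank xs e ≡ r
  rank-surjective {x ∷ xs} (x∉xs ∷ !xs) {r} _ with ℕₚ.<-cmp r (rank xs x)
  ... | tri≈ _ r≡k _ =
    x , here refl , trans (cong length (Listₚ.filter-reject (_≺? x) (≺-irrefl refl))) (sym r≡k)
  ... | tri< r<k _ _ =
    let e , e∈xs , rank≡r = rank-surjective !xs (ℕₚ.<-≤-trans r<k (Listₚ.length-filter (_≺? x) xs))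
        x⊀e = λ x≺e → ℕₚ.<⇒≱ r<k (subst (rank xs x ≤_) rank≡r (rank-mono xs x≺e))
    in e , there e∈xs , trans (cong length (Listₚ.filter-reject (_≺? e) x⊀e)) rank≡r
  rank-surjective {x ∷ xs} (x∉xs ∷ !xs) {suc r} (s≤s r<|xs|) | tri> _ _ k<1+r =
    let e , e∈xs , rank≡r = rank-surjective !xs r<|xs|
    in e , there e∈xs ,
       trans (cong length (Listₚ.filter-accept (_≺? e) (x≺e e∈xs rank≡r))) (cong suc rank≡r)
    where
      x≺e : ∀ {e} → e ∈ xs → rank xs e ≡ r → x ≺ e
      x≺e {e} e∈xs rank≡r with compare x e
      ... | tri< x≺e _ _ = x≺e
      ... | tri≈ _ refl _ = contradiction refl (All.lookup x∉xs e∈xs)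
      ... | tri> _ _ e≺x =
        contradiction (subst (_< rank xs x) rank≡r (rank-strict xs e∈xs e≺x)) (ℕₚ.≤⇒≯ (ℕ.s≤s⁻¹ k<1+r))
  rank-surjective {x ∷ xs} _ {zero} _ | tri> _ _ ()

when : {A : Set} → Dec A → ℕ → ℕ
when a? u = if does a? then u else 0

when-true : ∀ {A : Set} (a? : Dec A) {u} → A → when a? u ≡ u
when-true a? a rewrite dec-true a? a = refl

when-false : ∀ {A : Set} (a? : Dec A) {u} → ¬ A → when a? u ≡ 0
when-false a? ¬a rewrite dec-false a? ¬a = refl

weightFrom : {R : ℕ → ℤ → Set} → (∀ k s → Dec (R k s)) → ℕ → ℤ → List Step → ℕ
weightFrom R? off base []            = 0
weightFrom R? off base ((u , v) ∷ Q) =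
  when (R? (suc off) (base ℤ.+ v)) u + weightFrom R? (suc off) (base ℤ.+ v) Q

module _ {R : ℕ → ℤ → Set} (R? : ∀ k s → Dec (R k s)) where

  weightFrom-++ : ∀ off base A B → weightFrom R? off base (A ++ B) ≡
                  weightFrom R? off base A + weightFrom R? (off + length A) (base ℤ.+ sumV A) B
  weightFrom-++ off base [] B =
    sym (cong₂ (λ o b → weightFrom R? o b B) (ℕₚ.+-identityʳ off) (ℤₚ.+-identityʳ base))
  weightFrom-++ off base ((u , v) ∷ A) B
    rewrite weightFrom-++ (suc off) (base ℤ.+ v) A B
          | ℕₚ.+-suc off (length A) | ℤₚ.+-assoc base v (sumV A) =
      sym (ℕₚ.+-assoc (when (R? (suc off) (base ℤ.+ v)) u) _ _)

  sum-when≡weightFrom : ∀ off base Q →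
    sum (applyUpTo (λ k → when (R? (off + suc k) (base ℤ.+ sAt Q (suc k))) (xAt Q (suc k))) (length Q))
      ≡ weightFrom R? off base Q
  sum-when≡weightFrom off base []            = refl
  sum-when≡weightFrom off base ((u , v) ∷ Q) =
    cong₂ _+_ (when-cong (ℕₚ.+-comm off 1) (cong (ℤ._+_ base) (ℤₚ.+-identityʳ v)) (ℕₚ.+-identityʳ u))
              (trans (cong sum (applyUpTo-cong shift (length Q)))
                     (sum-when≡weightFrom (suc off) (base ℤ.+ v) Q))
    where
      when-cong : ∀ {k k′ s s′ x x′} → k ≡ k′ → s ≡ s′ → x ≡ x′ → when (R? k s) x ≡ when (R? k′ s′) x′
      when-cong refl refl refl = refl
      shift : ∀ k → when (R? (off + suc (suc k)) (base ℤ.+ (v ℤ.+ sAt Q (suc k)))) (xAt Q (suc k))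
                  ≡ when (R? (suc off + suc k) ((base ℤ.+ v) ℤ.+ sAt Q (suc k))) (xAt Q (suc k))
      shift k = when-cong (ℕₚ.+-suc off (suc k)) (sym (ℤₚ.+-assoc base v _)) refl

weightFrom-cong : ∀ {R R′ : ℕ → ℤ → Set} (R? : ∀ k s → Dec (R k s)) (R′? : ∀ k s → Dec (R′ k s))
  {off b b′} Q →
  (∀ k s → off < k → k ≤ off + length Q → R k (b ℤ.+ s) ⇔ R′ k (b′ ℤ.+ s)) →
  weightFrom R? off b Q ≡ weightFrom R′? off b′ Q
weightFrom-cong R? R′? []            _     = refl
weightFrom-cong {R} {R′} R? R′? {off} {b} {b′} ((u , v) ∷ Q) R⇔R′ =
  cong₂ _+_ (cong (λ c → if c then u else 0) (does-⇔ head⇔ (R? _ _) (R′? _ _)))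
            (weightFrom-cong R? R′? Q shifted)
  where
    off+1+|Q|≡1+off+|Q| : off + suc (length Q) ≡ suc off + length Q
    off+1+|Q|≡1+off+|Q| = ℕₚ.+-suc off (length Q)
    head⇔ : R (suc off) (b ℤ.+ v) ⇔ R′ (suc off) (b′ ℤ.+ v)
    head⇔ = R⇔R′ (suc off) v (ℕₚ.n<1+n off)
                 (subst (suc off ≤_) (sym off+1+|Q|≡1+off+|Q|) (s≤s (ℕₚ.m≤m+n off (length Q))))
    shifted : ∀ k s → suc off < k → k ≤ suc off + length Q →
              R k ((b ℤ.+ v) ℤ.+ s) ⇔ R′ k ((b′ ℤ.+ v) ℤ.+ s)
    shifted k s 1+off<k k≤ rewrite ℤₚ.+-assoc b v s | ℤₚ.+-assoc b′ v s =
      R⇔R′ k (v ℤ.+ s) (ℕₚ.<-trans (ℕₚ.n<1+n off) 1+off<k) (subst (k ≤_) (sym off+1+|Q|≡1+off+|Q|) k≤)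

nonPositive? : ∀ (k : ℕ) s → Dec (s ℤ.≤ + 0)
nonPositive? _ s = s ℤ.≤? + 0

nplFrom≡weightFrom : ∀ off t Q → nplFrom t Q ≡ weightFrom nonPositive? off t Q
nplFrom≡weightFrom off t []            = refl
nplFrom≡weightFrom off t ((u , v) ∷ Q) with (t ℤ.+ v) ℤ.≤? + 0
... | yes _ = cong (_+_ u) (nplFrom≡weightFrom (suc off) (t ℤ.+ v) Q)
... | no _  = nplFrom≡weightFrom (suc off) (t ℤ.+ v) Q

nplFrom-++ : ∀ t A B → nplFrom t (A ++ B) ≡ nplFrom t A + nplFrom (t ℤ.+ sumV A) B
nplFrom-++ t A B = begin
  nplFrom t (A ++ B)                                     ≡⟨ nplFrom≡weightFrom 0 t (A ++ B) ⟩
  weightFrom nonPositive? 0 t (A ++ B)                   ≡⟨ weightFrom-++ nonPositive? 0 t A B ⟩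
  weightFrom nonPositive? 0 t A
    + weightFrom nonPositive? (length A) (t ℤ.+ sumV A) B ≡⟨ cong₂ _+_ (nplFrom≡weightFrom 0 t A)
                                                               (nplFrom≡weightFrom (length A) _ B) ⟨
  nplFrom t A + nplFrom (t ℤ.+ sumV A) B                 ∎

sumV-++ : ∀ A B → sumV (A ++ B) ≡ sumV A ℤ.+ sumV B
sumV-++ []            B = sym (ℤₚ.+-identityˡ (sumV B))
sumV-++ ((_ , v) ∷ A) B = trans (cong (ℤ._+_ v) (sumV-++ A B)) (sym (ℤₚ.+-assoc v (sumV A) (sumV B)))

-- k <[ P ] i is definitionally Below (sAt P i) i k (sAt P k); abstracting the prefix sum lets
-- Below be evaluated on the running sums of a rotation of P.
Below : ℤ → ℕ → ℕ → ℤ → Set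
Below σ i k s = s ℤ.< σ ⊎ (s ≡ σ × i < k)

below? : ∀ σ i k s → Dec (Below σ i k s)
below? σ i k s = (s ℤ.<? σ) ⊎-dec ((s ℤ.≟ σ) ×-dec (i ℕ.<? k))

weightBelow : List Step → ℕ → ℕ
weightBelow P i = weightFrom (below? (sAt P i) i) 0 (+ 0) P

below-prefix⇔ : ∀ {σ T i k s} → σ ℤ.+ T ≡ + 1 → k ≤ i → Below σ i k s ⇔ T ℤ.+ s ℤ.≤ + 0
below-prefix⇔ {σ} {T} {i} {k} {s} σ+T≡1 k≤i = mk⇔ to from
  where
    1+s-σ≡T+s : ℤ.suc s ℤ.- σ ≡ T ℤ.+ s
    1+s-σ≡T+s = begin
      + 1 ℤ.+ s ℤ.- σ          ≡⟨ cong (λ o → o ℤ.+ s ℤ.- σ) σ+T≡1 ⟨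
      σ ℤ.+ T ℤ.+ s ℤ.- σ      ≡⟨ solve (σ ∷ T ∷ s ∷ []) ⟩
      T ℤ.+ s                  ∎
    to : Below σ i k s → T ℤ.+ s ℤ.≤ + 0
    to (inj₁ s<σ)       = subst (ℤ._≤ + 0) 1+s-σ≡T+s (ℤₚ.i≤j⇒i-j≤0 (ℤₚ.i<j⇒suc[i]≤j s<σ))
    to (inj₂ (_ , i<k)) = contradiction k≤i (ℕₚ.<⇒≱ i<k)
    from : T ℤ.+ s ℤ.≤ + 0 → Below σ i k s
    from T+s≤0 = inj₁ (ℤₚ.suc[i]≤j⇒i<j (ℤₚ.i-j≤0⇒i≤j (subst (ℤ._≤ + 0) (sym 1+s-σ≡T+s) T+s≤0)))

below-suffix⇔ : ∀ {σ i k s} → i < k → Below σ i k (σ ℤ.+ s) ⇔ s ℤ.≤ + 0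
below-suffix⇔ {σ} {i} {k} {s} i<k = mk⇔ to from
  where
    σ+s-σ≡s : σ ℤ.+ s ℤ.- σ ≡ s
    σ+s-σ≡s = solve (σ ∷ s ∷ [])
    to : Below σ i k (σ ℤ.+ s) → s ℤ.≤ + 0
    to below = subst (ℤ._≤ + 0) σ+s-σ≡s (ℤₚ.i≤j⇒i-j≤0 (σ+s≤σ below))
      where
        σ+s≤σ : Below σ i k (σ ℤ.+ s) → σ ℤ.+ s ℤ.≤ σ
        σ+s≤σ (inj₁ σ+s<σ)       = ℤₚ.<⇒≤ σ+s<σ
        σ+s≤σ (inj₂ (σ+s≡σ , _)) = ℤₚ.≤-reflexive σ+s≡σ
    from : s ℤ.≤ + 0 → Below σ i k (σ ℤ.+ s)
    from s≤0 with s ℤ.≟ + 0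
    ... | yes refl = inj₂ (ℤₚ.+-identityʳ σ , i<k)
    ... | no s≢0   =
      inj₁ (subst (σ ℤ.+ s ℤ.<_) (ℤₚ.+-identityʳ σ) (ℤₚ.+-monoʳ-< σ (ℤₚ.≤∧≢⇒< s≤0 s≢0)))

<[]-isStrictTotalOrder : ∀ P → IsStrictTotalOrder _≡_ (_<[ P ]_)
<[]-isStrictTotalOrder P = OrderMonomorphism.isStrictTotalOrder monomorphism
  (×-isStrictTotalOrder ℤₚ.<-isStrictTotalOrder (Flip.isStrictTotalOrder ℕₚ.<-isStrictTotalOrder))
  where
    monomorphism : IsOrderMonomorphism _≡_ (Pointwise _≡_ _≡_) (_<[ P ]_)
                     (×-Lex _≡_ ℤ._<_ (flip ℕ._<_)) (λ i → sAt P i , i)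
    monomorphism = record
      { isOrderHomomorphism = record { cong = λ { refl → refl , refl } ; mono = id }
      ; injective           = proj₂
      ; cancel              = id
      }

≺[]-isStrictTotalOrder : ∀ P → IsStrictTotalOrder _≡_ (_≺[ P ]_)
≺[]-isStrictTotalOrder P = OrderMonomorphism.isStrictTotalOrder monomorphism
  (×-isStrictTotalOrder (<[]-isStrictTotalOrder P) ℕₚ.<-isStrictTotalOrder)
  where
    monomorphism : IsOrderMonomorphism _≡_ (Pointwise _≡_ _≡_) (_≺[ P ]_)
                     (×-Lex _≡_ (_<[ P ]_) ℕ._<_) id
    monomorphism = record
      { isOrderHomomorphism = record { cong = ≡⇒≡×≡ ; mono = id }
      ; injective           = ≡×≡⇒≡
      ; cancel              = id
      }

module PLRank (P : List Step) = Rank (≺[]-isStrictTotalOrder P) (≺-dec P)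

PL-block : List Step → ℕ → List (ℕ × ℕ)
PL-block P k = map (suc k ,_) (upTo (xAt P (suc k)))

sum-xAt : ∀ Q → sum (applyUpTo (λ k → xAt Q (suc k)) (length Q)) ≡ sumU Q
sum-xAt []            = refl
sum-xAt ((u , _) ∷ Q) = cong₂ _+_ (ℕₚ.+-identityʳ u) (sum-xAt Q)

length-PL : ∀ P → length (PLindices P) ≡ sumU P
length-PL P = begin
  length (concat (map (PL-block P) (upTo N)))        ≡⟨ length-concat (map (PL-block P) (upTo N)) ⟩
  sum (map length (map (PL-block P) (upTo N)))       ≡⟨ cong sum (Listₚ.map-∘ (upTo N)) ⟨
  sum (map (length ∘ PL-block P) (upTo N))           ≡⟨ cong sum (Listₚ.map-upTo (length ∘ PL-block P) N) ⟩
  sum (applyUpTo (length ∘ PL-block P) N)            ≡⟨ cong sum (applyUpTo-cong block-length N) ⟩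
  sum (applyUpTo (λ k → xAt P (suc k)) N)            ≡⟨ sum-xAt P ⟩
  sumU P                                             ∎
  where
    N = length P
    block-length : ∀ k → length (PL-block P k) ≡ xAt P (suc k)
    block-length k = trans (Listₚ.length-map _ (upTo (xAt P (suc k)))) (Listₚ.length-upTo _)

PL-unique : ∀ P → Unique (PLindices P)
PL-unique P = Uniqueₚ.concat⁺ (Allₚ.map⁺ (All.universal block-unique _))
                              (AllPairsₚ.map⁺ (AllPairsₚ.applyUpTo⁺₁ id (length P) blocks-disjoint))
  where
    block-unique : ∀ k → Unique (PL-block P k)
    block-unique k = Uniqueₚ.map⁺ (cong proj₂) (Uniqueₚ.upTo⁺ _)
    blocks-disjoint : ∀ {k l} → k < l → l < length P → Disjoint (PL-block P k) (PL-block P l)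
    blocks-disjoint k<l _ (e∈k , e∈l) with ∈-map⁻ _ e∈k | ∈-map⁻ _ e∈l
    ... | _ , _ , refl | _ , _ , eq = ℕₚ.<⇒≢ k<l (ℕₚ.suc-injective (cong proj₁ eq))

length-filter-PL : ∀ P {Q : Pred (ℕ × ℕ) 0ℓ} (Q? : U.Decidable Q) →
  length (filter Q? (PLindices P)) ≡ sum (applyUpTo (length ∘ filter Q? ∘ PL-block P) (length P))
length-filter-PL P Q? = begin
  length (filter Q? (concat blocks))
    ≡⟨ cong length (filter-concat Q? blocks) ⟩
  length (concat (map (filter Q?) blocks))
    ≡⟨ length-concat (map (filter Q?) blocks) ⟩
  sum (map length (map (filter Q?) blocks))
    ≡⟨ cong sum (trans (Listₚ.map-∘ (upTo N)) (Listₚ.map-∘ blocks)) ⟨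
  sum (map (length ∘ filter Q? ∘ PL-block P) (upTo N))
    ≡⟨ cong sum (Listₚ.map-upTo _ N) ⟩
  sum (applyUpTo (length ∘ filter Q? ∘ PL-block P) N)
    ∎
  where
    N = length P
    blocks = map (PL-block P) (upTo N)

∈PL⇒InPL : ∀ P {e} → e ∈ PLindices P → InPL P e
∈PL⇒InPL P e∈PL with ∈-concat⁻′ (map (PL-block P) (upTo (length P))) e∈PL
... | _ , e∈block , block∈ with ∈-map⁻ (PL-block P) block∈
...   | k , k∈ , refl with ∈-map⁻ (suc k ,_) e∈block
...     | j , j∈ , refl = (s≤s z≤n , ∈-upTo⁻ k∈) , ∈-upTo⁻ j∈

module _ (P : List Step) where
  open PLRank P

  _≺?_ : ∀ a b → Dec (a ≺[ P ] b)
  _≺?_ = ≺-dec P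

  rank-block : ∀ {i j} k → j ≤ xAt P i → (k<i? : Dec (k <[ P ] i)) (k≟i : Dec (k ≡ i)) →
    length (filter (_≺? (i , j)) (map (k ,_) (upTo (xAt P k)))) ≡ when k<i? (xAt P k) + when k≟i j
  rank-block k j≤xᵢ (yes k<k) (yes refl) =
    contradiction k<k (IsStrictTotalOrder.irrefl (<[]-isStrictTotalOrder P) refl)
  rank-block {i} {j} k _ (yes k<i) (no _) = begin
    length (filter (_≺? (i , j)) (map (k ,_) (upTo x))) ≡⟨ cong length (Listₚ.filter-all _ all≺) ⟩
    length (map (k ,_) (upTo x))                        ≡⟨ Listₚ.length-map _ (upTo x) ⟩
    length (upTo x)                                     ≡⟨ Listₚ.length-upTo x ⟩
    x                                                   ≡⟨ ℕₚ.+-identityʳ x ⟨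
    x + 0                                               ∎
    where
      x = xAt P k
      all≺ : All (_≺[ P ] (i , j)) (map (k ,_) (upTo x))
      all≺ = Allₚ.map⁺ (All.universal (λ _ → inj₁ k<i) (upTo x))
  rank-block {i} {j} k _ (no k≮i) (no k≢i) =
    cong length (Listₚ.filter-none (_≺? (i , j)) (Allₚ.map⁺ (All.universal ⊀ (upTo (xAt P k)))))
    where
      ⊀ : ∀ j′ → ¬ ((k , j′) ≺[ P ] (i , j))
      ⊀ _ (inj₁ k<i)       = k≮i k<i
      ⊀ _ (inj₂ (k≡i , _)) = k≢i k≡i
  rank-block {j = j} k j≤xₖ (no k≮k) (yes refl) = begin
    length (filter (_≺? (k , j)) (map (k ,_) (upTo x))) ≡⟨ length-filter-map _ (k ,_) (upTo x) ⟩
    length (filter ((_≺? (k , j)) ∘ (k ,_)) (upTo x))   ≡⟨ cong length (Listₚ.filter-≐ _ _ ≺⇔< (upTo x)) ⟩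
    length (filter (ℕ._<? j) (upTo x))                  ≡⟨ cong length (filter-<-upTo x j≤xₖ) ⟩
    length (upTo j)                                     ≡⟨ Listₚ.length-upTo j ⟩
    j                                                   ∎
    where
      x = xAt P k
      ≺⇔< : (λ j′ → (k , j′) ≺[ P ] (k , j)) U.≐ (ℕ._< j)
      ≺⇔< = (λ { (inj₁ k<k) → contradiction k<k k≮k ; (inj₂ (_ , j′<j)) → j′<j })
          , (λ j′<j → inj₂ (refl , j′<j))

  rank-PL : ∀ {i j} → 1 ≤ i → i ≤ length P → j ≤ xAt P i → rank (PLindices P) (i , j) ≡ weightBelow P i + j
  rank-PL {suc t} {j} _ i≤N j≤xᵢ = begin
    length (filter (_≺? (i , j)) (PLindices P))        ≡⟨ length-filter-PL P (_≺? (i , j)) ⟩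
    sum (applyUpTo (length ∘ filter (_≺? (i , j)) ∘ PL-block P) N)
                                                       ≡⟨ cong sum (applyUpTo-cong by-block N) ⟩
    sum (applyUpTo (λ k → earlier k + same k) N)       ≡⟨ sum-applyUpTo-+ earlier same N ⟩
    sum (applyUpTo earlier N) + sum (applyUpTo same N) ≡⟨ cong₂ _+_ earlier-sum same-sum ⟩
    weightBelow P i + j                                ∎
    where
      i = suc t
      N = length P
      σ = sAt P i
      earlier same : ℕ → ℕ
      earlier k = when (below? σ i (suc k) (sAt P (suc k))) (xAt P (suc k))
      same k = when (suc k ℕ.≟ i) j
      by-block : ∀ k → length (filter (_≺? (i , j)) (PL-block P k)) ≡ earlier k + same k
      by-block k = rank-block (suc k) j≤xᵢ (below? σ i (suc k) (sAt P (suc k))) (suc k ℕ.≟ i)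
      earlier-sum : sum (applyUpTo earlier N) ≡ weightBelow P i
      earlier-sum = trans (cong sum (applyUpTo-cong 0+s N)) (sum-when≡weightFrom (below? σ i) 0 (+ 0) P)
        where
          0+s : ∀ k → earlier k ≡ when (below? σ i (suc k) (+ 0 ℤ.+ sAt P (suc k))) (xAt P (suc k))
          0+s k = cong (λ s → when (below? σ i (suc k) s) (xAt P (suc k)))
                       (sym (ℤₚ.+-identityˡ (sAt P (suc k))))
      same-sum : sum (applyUpTo same N) ≡ j
      same-sum = trans (sum-applyUpTo-single same i≤N
                          (λ k k≢t → when-false (suc k ℕ.≟ i) (k≢t ∘ ℕₚ.suc-injective)))
                       (when-true (i ℕ.≟ i) refl)

NPL-rot : ∀ P {i} → i ≤ length P → sumV P ≡ + 1 → NPL (rot P i) ≡ weightBelow P i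
NPL-rot P {i} i≤N ΣP≡1 = begin
  nplFrom (+ 0) (Dr ++ Tk)
    ≡⟨ nplFrom-++ (+ 0) Dr Tk ⟩
  nplFrom (+ 0) Dr + nplFrom (+ 0 ℤ.+ T) Tk
    ≡⟨ ℕₚ.+-comm (nplFrom (+ 0) Dr) _ ⟩
  nplFrom (+ 0 ℤ.+ T) Tk + nplFrom (+ 0) Dr
    ≡⟨ cong₂ _+_ (nplFrom≡weightFrom 0 _ Tk) (nplFrom≡weightFrom (length Tk) _ Dr) ⟩
  weightFrom nonPositive? 0 (+ 0 ℤ.+ T) Tk + weightFrom nonPositive? (length Tk) (+ 0) Dr
    ≡⟨ cong₂ _+_ (weightFrom-cong B nonPositive? Tk prefix) (weightFrom-cong B nonPositive? Dr suffix) ⟨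
  weightFrom B 0 (+ 0) Tk + weightFrom B (length Tk) (+ 0 ℤ.+ σ) Dr
    ≡⟨ weightFrom-++ B 0 (+ 0) Tk Dr ⟨
  weightFrom B 0 (+ 0) (Tk ++ Dr)
    ≡⟨ cong (weightFrom B 0 (+ 0)) (Listₚ.take++drop≡id i P) ⟩
  weightBelow P i
    ∎
  where
    Tk = take i P
    Dr = drop i P
    σ = sumV Tk
    T = sumV Dr
    B = below? σ i
    σ+T≡1 : σ ℤ.+ T ≡ + 1
    σ+T≡1 = trans (sym (sumV-++ Tk Dr)) (trans (cong sumV (Listₚ.take++drop≡id i P)) ΣP≡1)
    |Tk|≡i : length Tk ≡ i
    |Tk|≡i = trans (Listₚ.length-take i P) (ℕₚ.m≤n⇒m⊓n≡m i≤N)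
    prefix : ∀ k s → 0 < k → k ≤ length Tk → Below σ i k (+ 0 ℤ.+ s) ⇔ (+ 0 ℤ.+ T) ℤ.+ s ℤ.≤ + 0
    prefix k s _ k≤|Tk| rewrite ℤₚ.+-identityˡ s | ℤₚ.+-identityˡ T =
      below-prefix⇔ σ+T≡1 (subst (k ≤_) |Tk|≡i k≤|Tk|)
    suffix : ∀ k s → length Tk < k → k ≤ length Tk + length Dr →
             Below σ i k ((+ 0 ℤ.+ σ) ℤ.+ s) ⇔ + 0 ℤ.+ s ℤ.≤ + 0
    suffix k s |Tk|<k _ rewrite ℤₚ.+-identityˡ s | ℤₚ.+-identityˡ σ =
      below-suffix⇔ (subst (_< k) |Tk|≡i |Tk|<k)

theorem3p6 : (n m : ℕ) → 1 ≤ n → n + 1 ≤ m → (P : List Step) → IsLatticePath n m P →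
    (r : ℕ) → 1 ≤ r → r ≤ m →
      Σ (ℕ × ℕ) (λ e → IsTheta P r e)
      × ((e : ℕ × ℕ) → IsTheta P r e → PNPLat P e ≡ r ∸ 1)
theorem3p6 _ _ _ _ _ _ zero () _
theorem3p6 _ m _ _ P (_ , _ , Σy≡1 , Σx≡m) (suc r) _ r<m = Θ-exists , PNPL-Θ
  where
    open PLRank P
    Θ-exists : Σ (ℕ × ℕ) (λ e → IsTheta P (suc r) e)
    Θ-exists =
      let r<|PL| = subst (r <_) (sym (trans (length-PL P) Σx≡m)) r<m
          e , e∈PL , rank≡r = rank-surjective (PL-unique P) r<|PL|
      in e , ∈PL⇒InPL P e∈PL , rank≡r
    PNPL-Θ : (e : ℕ × ℕ) → IsTheta P (suc r) e → PNPLat P e ≡ r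
    PNPL-Θ (i , j) (((1≤i , i≤N) , j<xᵢ) , rank≡r) = begin
      NPL (rot P i) + j            ≡⟨ cong (_+ j) (NPL-rot P i≤N Σy≡1) ⟩
      weightBelow P i + j          ≡⟨ rank-PL P 1≤i i≤N (ℕₚ.<⇒≤ j<xᵢ) ⟨
      rank (PLindices P) (i , j)   ≡⟨ rank≡r ⟩
      r                            ∎
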